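{- Let $d$ be a positive integer and let $H$ be a bipartite graph with bipartition $\{X, Y\}$ such that $d_H(x) < d$ for every $x \in X$. Then $H$ can be decomposed into $(\mathrm{SF}_1, \ldots, \mathrm{SF}_d, R)$, where $\mathrm{SF}_1, \ldots, \mathrm{SF}_d$ are pairwise isomorphic star forests, each with at most $|Y|$ components, whose stars have size at most $\Delta(H)/d$, and $R$ satisfies $\Delta(R) < d$.
   Context: A decomposition of a graph $G$ into $(G_1,\dots,G_r)$ means that $G_1,\dots,G_r$ are pairwise edge-disjoint subgraphs of $G$ whose edge sets together cover $E(G)$. A star forest is a vertex-disjoint union of stars; the size of a star is its number of edges. $\Delta(\cdot)$ denotes maximum degree. -}

module Defs where

open import Data.Nat using (ℕ; zero; suc; _+_; _*_; _≤_; _<_; _⊔_)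
open import Data.Bool using (Bool; true; false; _∧_; _xor_; if_then_else_)
open import Data.Fin using (Fin)
import Data.Fin as F
import Data.Fin.Properties as FP
open import Data.Maybe using (Maybe; just; nothing)
open import Data.Maybe.Properties using (≡-dec)
open import Data.Sum using (_⊎_; inj₁; inj₂)
open import Data.Product using (Σ; _×_)
open import Function using (_∘_)
open import Function.Bundles using (_↔_; Inverse)
open import Relation.Nullary.Decidable using (⌊_⌋)
open import Relation.Binary.PropositionalEquality using (_≡_)

-- A finite bipartite graph with a fixed bipartition {X, Y}, X = Fin a, Y = Fin b:
-- G x y ≡ true  iff  x ∈ X and y ∈ Y are adjacent.
BipGraph : ℕ → ℕ → Set
BipGraph a b = Fin a → Fin b → Bool

count : ∀ {n} → (Fin n → Bool) → ℕ
count {zero}  f = 0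
count {suc n} f = (if f F.zero then 1 else 0) + count (f ∘ F.suc)

maxF : ∀ {n} → (Fin n → ℕ) → ℕ
maxF {zero}  f = 0
maxF {suc n} f = f F.zero ⊔ maxF (f ∘ F.suc)

V : ℕ → ℕ → Set
V a b = Fin a ⊎ Fin b

Adj : ∀ {a b} → BipGraph a b → V a b → V a b → Bool
Adj G (inj₁ x) (inj₁ x′) = false
Adj G (inj₁ x) (inj₂ y)  = G x y
Adj G (inj₂ y) (inj₁ x)  = G x y
Adj G (inj₂ y) (inj₂ y′) = false

deg : ∀ {a b} → BipGraph a b → V a b → ℕ
deg G (inj₁ x) = count (λ y → G x y)
deg G (inj₂ y) = count (λ x → G x y)

Δ : ∀ {a b} → BipGraph a b → ℕ
Δ G = maxF (λ x → deg G (inj₁ x)) ⊔ maxF (λ y → deg G (inj₂ y))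

countV : ∀ {a b} → (V a b → Bool) → ℕ
countV f = count (f ∘ inj₁) + count (f ∘ inj₂)

-- A decomposition of G into (G_1, ..., G_d, R) is given by a labelling of the edges:
-- label just i puts the edge into G_i, label nothing puts it into R.
Labelling : ℕ → ℕ → ℕ → Set
Labelling d a b = Fin a → Fin b → Maybe (Fin d)

part : ∀ {d a b} → BipGraph a b → Labelling d a b → Maybe (Fin d) → BipGraph a b
part G col m x y = G x y ∧ ⌊ ≡-dec FP._≟_ (col x y) m ⌋

Isomorphic : ∀ {a b} → BipGraph a b → BipGraph a b → Set
Isomorphic {a} {b} G G′ =
  Σ (V a b ↔ V a b) λ σ → ∀ u v → Adj G u v ≡ Adj G′ (Inverse.to σ u) (Inverse.to σ v)

-- C is a set of star centres exhibiting G as a star forest (vertex-disjoint union of stars):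
-- every edge has exactly one endpoint in C, and every non-centre has degree ≤ 1.
-- The stars are then the centres of positive degree together with their neighbours.
IsStarCentres : ∀ {a b} → BipGraph a b → (V a b → Bool) → Set
IsStarCentres G C =
  (∀ x y → G x y ≡ true → (C (inj₁ x) xor C (inj₂ y)) ≡ true) ×
  (∀ v → C v ≡ false → deg G v ≤ 1)

-- number of stars (= number of components of the star forest, isolated vertices not counted)
numStars : ∀ {a b} → BipGraph a b → (V a b → Bool) → ℕ
numStars G C = countV (λ v → C v ∧ ⌊ 1 Data.Nat.≤? deg G v ⌋)
  where import Data.Nat

StarForestBounded : ∀ {a b} → BipGraph a b → (k d D : ℕ) → Set
StarForestBounded G k d D =
  Σ (_ → Bool) λ C → IsStarCentres G C × numStars G C ≤ k ×
    (∀ v → C v ≡ true → d * deg G v ≤ D)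

-- Cut the neighbours of each y ∈ Y, in order, into ⌊deg y / d⌋ blocks of d and make each block
-- the neighbourhood of a new vertex; the remaining deg y mod d < d edges at y form R. Since every
-- x has degree < d, the split graph has maximum degree ≤ d, so by Kőnig's theorem (proved by
-- swapping colours along alternating paths) it has a proper d-edge-colouring, and each new vertex,
-- having degree d, sees every colour. Hence colour class i has at most one edge at each x and exactly
-- ⌊deg y / d⌋ ≤ Δ(H)/d edges at each y: it is a star forest centred in Y, and two such classes, having
-- the same degrees on Y, differ by a permutation of X.

module Submission where

open import Defs
open import Data.Nat using (ℕ; zero; suc; _+_; _*_; _∸_; _≤_; _<_; z≤n; s≤s; s≤s⁻¹; _<ᵇ_; _≡ᵇ_; NonZero; _≤?_)
open import Data.Nat.Properties
open import Data.Nat.DivMod using (_/_; _%_; m%n<n; m≡m%n+[m/n]*n; m/n≤m; m/n*n≤m; m%n≡m∸m/n*n; m<n*o⇒m/o<n; m<n⇒m/n≡0; m*n/n≡m; +-distrib-/-∣ʳ)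
open import Data.Nat.Divisibility using (divides-refl)
open import Algebra.Properties.CommutativeSemigroup +-commutativeSemigroup using (interchange)
open import Data.Bool using (Bool; true; false; _∧_; not; if_then_else_)
open import Data.Bool.Properties using (T-≡; ∧-identityʳ)
open import Data.Fin using (Fin; toℕ; fromℕ<)
import Data.Fin as F
import Data.Fin.Properties as FP
open import Data.Fin.Permutation.Components using (transpose; transpose-inverse)
open import Data.Maybe using (Maybe; just; nothing; _>>=_)
open import Data.Maybe.Properties using (≡-dec; just-injective)
open import Data.Product using (Σ; ∃; _×_; _,_; proj₁; proj₂; map₂)
open import Data.Sum using (_⊎_; inj₁; inj₂)
open import Data.Sum.Function.Propositional using (_⊎-↔_)
open import Data.List using (List; []; _∷_; cartesianProduct; allFin)
open import Data.List.Membership.Propositional using (_∈_)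
open import Data.List.Membership.Propositional.Properties using (∈-cartesianProduct⁺; ∈-allFin)
open import Data.List.Relation.Unary.Any using (here; there)
open import Data.Empty using (⊥; ⊥-elim)
open import Function using (_∘_; flip)
open import Function.Bundles using (_↔_; Inverse; mk↔ₛ′; Equivalence)
open import Function.Construct.Identity using (↔-id)
open import Function.Definitions using (Injective)
open import Relation.Nullary using (¬_; Dec; yes; no)
open import Relation.Binary using (tri<; tri≈; tri>)
open import Relation.Binary.PropositionalEquality

private
  variable
    n m : ℕ

<ᵇ-true : ∀ m n → m < n → (m <ᵇ n) ≡ true
<ᵇ-true m n m<n = Equivalence.to T-≡ (<⇒<ᵇ m<n)

<ᵇ-true⁻¹ : ∀ {m n} → (m <ᵇ n) ≡ true → m < n
<ᵇ-true⁻¹ {m} {n} e = <ᵇ⇒< m n (Equivalence.from T-≡ e)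

<ᵇ-false : ∀ m n → n ≤ m → (m <ᵇ n) ≡ false
<ᵇ-false m n n≤m with m <ᵇ n in e
... | false = refl
... | true  = ⊥-elim (≤⇒≯ n≤m (<ᵇ-true⁻¹ e))

≡ᵇ-refl : ∀ m → (m ≡ᵇ m) ≡ true
≡ᵇ-refl m = Equivalence.to T-≡ (≡⇒≡ᵇ m m refl)

≡ᵇ-true⁻¹ : ∀ {m n} → (m ≡ᵇ n) ≡ true → m ≡ n
≡ᵇ-true⁻¹ {m} {n} e = ≡ᵇ⇒≡ m n (Equivalence.from T-≡ e)

≡ᵇ-false : ∀ m n → m ≢ n → (m ≡ᵇ n) ≡ false
≡ᵇ-false m n m≢n with m ≡ᵇ n in e
... | false = refl
... | true  = ⊥-elim (m≢n (≡ᵇ-true⁻¹ e))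

-- Counting on Fin n

indicator : Bool → ℕ
indicator b = if b then 1 else 0

count≤n : (P : Fin n → Bool) → count P ≤ n
count≤n {zero}  P = z≤n
count≤n {suc n} P with P F.zero
... | true  = s≤s (count≤n (P ∘ F.suc))
... | false = m≤n⇒m≤1+n (count≤n (P ∘ F.suc))

count-≡0 : (P : Fin n → Bool) → (∀ i → P i ≡ false) → count P ≡ 0
count-≡0 {zero}  P all-false = refl
count-≡0 {suc n} P all-false rewrite all-false F.zero = count-≡0 (P ∘ F.suc) (all-false ∘ F.suc)

count-≡n : (P : Fin n → Bool) → (∀ i → P i ≡ true) → count P ≡ n
count-≡n {zero}  P all-true = refl
count-≡n {suc n} P all-true rewrite all-true F.zero = cong suc (count-≡n (P ∘ F.suc) (all-true ∘ F.suc))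

count-+ : (P Q R : Fin n → Bool) → (∀ i → indicator (R i) ≡ indicator (P i) + indicator (Q i)) →
  count R ≡ count P + count Q
count-+ {zero}  P Q R R≡P+Q = refl
count-+ {suc n} P Q R R≡P+Q = begin
  indicator (R F.zero) + count (R ∘ F.suc)
    ≡⟨ cong₂ _+_ (R≡P+Q F.zero) (count-+ (P ∘ F.suc) (Q ∘ F.suc) (R ∘ F.suc) (R≡P+Q ∘ F.suc)) ⟩
  (p + q) + (count (P ∘ F.suc) + count (Q ∘ F.suc))
    ≡⟨ interchange p q (count (P ∘ F.suc)) (count (Q ∘ F.suc)) ⟩
  (p + count (P ∘ F.suc)) + (q + count (Q ∘ F.suc)) ∎
  where
  open ≡-Reasoning
  p = indicator (P F.zero)
  q = indicator (Q F.zero)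

rank : (Fin n → Bool) → Fin n → ℕ
rank P F.zero    = 0
rank P (F.suc i) = indicator (P F.zero) + rank (P ∘ F.suc) i

rank-suc : (P : Fin (suc n) → Bool) {b : Bool} → P F.zero ≡ b → (i : Fin n) →
  rank P (F.suc i) ≡ indicator b + rank (P ∘ F.suc) i
rank-suc P refl i = refl

rank<count : (P : Fin n → Bool) (i : Fin n) → P i ≡ true → rank P i < count P
rank<count P F.zero    Pi rewrite Pi = s≤s z≤n
rank<count P (F.suc i) Pi = +-monoʳ-< (indicator (P F.zero)) (rank<count (P ∘ F.suc) i Pi)

rank<n : (P : Fin n → Bool) (i : Fin n) → rank P i < n
rank<n P F.zero    = s≤s z≤n
rank<n P (F.suc i) with P F.zero
... | true  = s≤s (rank<n (P ∘ F.suc) i)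
... | false = m<n⇒m<1+n (rank<n (P ∘ F.suc) i)

rank-strictMono : (P : Fin n → Bool) (i j : Fin n) → toℕ i < toℕ j → P i ≡ true → rank P i < rank P j
rank-strictMono P F.zero    (F.suc j) i<j     Pi rewrite Pi = s≤s z≤n
rank-strictMono P (F.suc i) (F.suc j) (s≤s i<j) Pi =
  +-monoʳ-< (indicator (P F.zero)) (rank-strictMono (P ∘ F.suc) i j i<j Pi)

rank-injective : (P : Fin n → Bool) {i j : Fin n} → P i ≡ true → P j ≡ true → rank P i ≡ rank P j → i ≡ j
rank-injective P {i} {j} Pi Pj ri≡rj with <-cmp (toℕ i) (toℕ j)
... | tri< i<j _ _ = ⊥-elim (<-irrefl ri≡rj (rank-strictMono P i j i<j Pi))
... | tri≈ _ i≡j _ = FP.toℕ-injective i≡j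
... | tri> _ _ j<i = ⊥-elim (<-irrefl (sym ri≡rj) (rank-strictMono P j i j<i Pj))

rank-surjective : (P : Fin n → Bool) (k : ℕ) → k < count P → ∃ λ i → P i ≡ true × rank P i ≡ k
rank-surjective {suc n} P k k<c with P F.zero in P0
rank-surjective {suc n} P zero    _         | true = F.zero , P0 , refl
rank-surjective {suc n} P (suc k) (s≤s k<c) | true with rank-surjective (P ∘ F.suc) k k<c
... | i , Pi , ri = F.suc i , Pi , trans (rank-suc P P0 i) (cong suc ri)
rank-surjective {suc n} P k k<c | false with rank-surjective (P ∘ F.suc) k k<c
... | i , Pi , ri = F.suc i , Pi , trans (rank-suc P P0 i) ri

count-rank≥ : (P : Fin n → Bool) (k : ℕ) → count (λ i → P i ∧ not (rank P i <ᵇ k)) ≡ count P ∸ k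
count-rank≥ {zero}  P k = sym (0∸n≡0 k)
count-rank≥ {suc n} P k with P F.zero
count-rank≥ {suc n} P zero    | true = cong suc (count-rank≥ (P ∘ F.suc) 0)
count-rank≥ {suc n} P (suc k) | true = count-rank≥ (P ∘ F.suc) k
count-rank≥ {suc n} P k       | false = count-rank≥ (P ∘ F.suc) k

enum : (P : Fin n → Bool) → Fin (count P) → Fin n
enum P k = proj₁ (rank-surjective P (toℕ k) (FP.toℕ<n k))

enum-∈ : (P : Fin n → Bool) (k : Fin (count P)) → P (enum P k) ≡ true
enum-∈ P k = proj₁ (proj₂ (rank-surjective P (toℕ k) (FP.toℕ<n k)))

rank-enum : (P : Fin n → Bool) (k : Fin (count P)) → rank P (enum P k) ≡ toℕ k
rank-enum P k = proj₂ (proj₂ (rank-surjective P (toℕ k) (FP.toℕ<n k)))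

count-≤-injection : {P : Fin n → Bool} {Q : Fin m → Bool} (f : ∀ i → P i ≡ true → Fin m) →
  (∀ i Pi → Q (f i Pi) ≡ true) → (∀ {i j} Pi Pj → f i Pi ≡ f j Pj → i ≡ j) → count P ≤ count Q
count-≤-injection {P = P} {Q} f f-into f-injective = FP.injective⇒≤ {f = g} g-injective
  where
  g : Fin (count P) → Fin (count Q)
  g k = fromℕ< (rank<count Q _ (f-into (enum P k) (enum-∈ P k)))
  g-injective : Injective _≡_ _≡_ g
  g-injective {k} {k′} gk≡gk′ = FP.toℕ-injective (begin
    toℕ k                   ≡⟨ rank-enum P k ⟨
    rank P (enum P k)       ≡⟨ cong (rank P) enum-k≡enum-k′ ⟩
    rank P (enum P k′)      ≡⟨ rank-enum P k′ ⟩
    toℕ k′                  ∎)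
    where
    open ≡-Reasoning
    enum-k≡enum-k′ : enum P k ≡ enum P k′
    enum-k≡enum-k′ = f-injective (enum-∈ P k) (enum-∈ P k′)
      (rank-injective Q (f-into _ _) (f-into _ _)
        (FP.fromℕ<-injective _ _ (rank<count Q _ (f-into _ _)) (rank<count Q _ (f-into _ _)) gk≡gk′))

injective⇒≤count : {P : Fin n → Bool} (f : Fin m → Fin n) → Injective _≡_ _≡_ f →
  (∀ k → P (f k) ≡ true) → m ≤ count P
injective⇒≤count {m = m} {P = P} f f-injective f-into = begin
  m                        ≡⟨ count-≡n (λ _ → true) (λ _ → refl) ⟨
  count {m} (λ _ → true)  ≤⟨ count-≤-injection (λ k _ → f k) (λ k _ → f-into k) (λ _ _ → f-injective) ⟩
  count P                  ∎
  where open ≤-Reasoning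

injective⇒count≤ : {P : Fin n → Bool} (f : ∀ i → P i ≡ true → Fin m) →
  (∀ {i j} Pi Pj → f i Pi ≡ f j Pj → i ≡ j) → count P ≤ m
injective⇒count≤ {m = m} {P = P} f f-injective = begin
  count P                  ≤⟨ count-≤-injection f (λ _ _ → refl) f-injective ⟩
  count {m} (λ _ → true)  ≡⟨ count-≡n (λ _ → true) (λ _ → refl) ⟩
  m                        ∎
  where open ≤-Reasoning

count-mono : {P Q : Fin n → Bool} → (∀ i → P i ≡ true → Q i ≡ true) → count P ≤ count Q
count-mono P⊆Q = count-≤-injection (λ i _ → i) P⊆Q (λ _ _ i≡j → i≡j)

count-cong : {P Q : Fin n → Bool} → (∀ i → P i ≡ Q i) → count P ≡ count Q
count-cong P≗Q = ≤-antisym (count-mono λ i Pi → trans (sym (P≗Q i)) Pi) (count-mono λ i Qi → trans (P≗Q i) Qi)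

≤-maxF : (f : Fin n → ℕ) (i : Fin n) → f i ≤ maxF f
≤-maxF f F.zero    = m≤m⊔n _ _
≤-maxF f (F.suc i) = ≤-trans (≤-maxF (f ∘ F.suc) i) (m≤n⊔m _ _)

maxF< : ∀ {k} (f : Fin n → ℕ) → 0 < k → (∀ i → f i < k) → maxF f < k
maxF< {zero}  f 0<k f<k = 0<k
maxF< {suc n} f 0<k f<k = ⊔-lub (f<k F.zero) (maxF< (f ∘ F.suc) 0<k (f<k ∘ F.suc))

deg≤Δ : ∀ {a b} (G : BipGraph a b) (v : V a b) → deg G v ≤ Δ G
deg≤Δ G (inj₁ x) = ≤-trans (≤-maxF _ x) (m≤m⊔n _ _)
deg≤Δ G (inj₂ y) = ≤-trans (≤-maxF _ y) (m≤n⊔m _ _)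

Δ< : ∀ {a b k} (G : BipGraph a b) → 0 < k → (∀ v → deg G v < k) → Δ G < k
Δ< G 0<k deg<k = ⊔-lub (maxF< _ 0<k (deg<k ∘ inj₁)) (maxF< _ 0<k (deg<k ∘ inj₂))

-- Kőnig's edge-colouring theorem

_≟ᴹ_ : ∀ {d} (c c′ : Maybe (Fin d)) → Dec (c ≡ c′)
_≟ᴹ_ = ≡-dec FP._≟_

record ProperColouring {d a b} (G : BipGraph a b) (col : Labelling d a b) : Set where
  field
    coloured⇒edge : ∀ {x y c} → col x y ≡ just c → G x y ≡ true
    injectiveˣ    : ∀ {x y y′ c} → col x y ≡ just c → col x y′ ≡ just c → y ≡ y′
    injectiveʸ    : ∀ {x x′ y c} → col x y ≡ just c → col x′ y ≡ just c → x ≡ x′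

Coloured : ∀ {d a b} → Labelling d a b → Fin a → Fin b → Set
Coloured col x y = ∃ λ c → col x y ≡ just c

flip-proper : ∀ {d a b} {G : BipGraph a b} {col : Labelling d a b} →
  ProperColouring G col → ProperColouring (flip G) (flip col)
flip-proper proper = record
  { coloured⇒edge = coloured⇒edge ; injectiveˣ = injectiveʸ ; injectiveʸ = injectiveˣ }
  where open ProperColouring proper

missing-colourˣ : ∀ {d a b} {G : BipGraph a b} {col : Labelling d a b} {x y₀} →
  ProperColouring G col → deg G (inj₁ x) ≤ d → G x y₀ ≡ true → col x y₀ ≡ nothing →
  ∃ λ c → ∀ y → col x y ≢ just c
missing-colourˣ {d} {b = b} {G} {col} {x} {y₀} proper deg≤d edge uncoloured =
  map₂ (λ ¬present y e → ¬present (y , e))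
    (FP.¬∀⟶∃¬ d _ (λ c → FP.any? λ y → col x y ≟ᴹ just c) ¬all-present)
  where
  open ProperColouring proper
  ¬all-present : ¬ (∀ c → ∃ λ y → col x y ≡ just c)
  ¬all-present present = 1+n≰n (≤-trans (injective⇒≤count f f-injective f-edge) deg≤d)
    where
    f : Fin (suc d) → Fin b
    f F.zero    = y₀
    f (F.suc c) = proj₁ (present c)
    f-edge : ∀ k → G x (f k) ≡ true
    f-edge F.zero    = edge
    f-edge (F.suc c) = coloured⇒edge (proj₂ (present c))
    y₀-uncoloured : ∀ {c} → f (F.suc c) ≢ y₀
    y₀-uncoloured {c} e with trans (sym uncoloured) (trans (cong (col x) (sym e)) (proj₂ (present c)))
    ... | ()
    f-injective : Injective _≡_ _≡_ f
    f-injective {F.zero}  {F.zero}   _ = refl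
    f-injective {F.zero}  {F.suc c}  e = ⊥-elim (y₀-uncoloured (sym e))
    f-injective {F.suc c} {F.zero}   e = ⊥-elim (y₀-uncoloured e)
    f-injective {F.suc c} {F.suc c′} e =
      cong F.suc (just-injective (trans (sym (proj₂ (present c))) (trans (cong (col x) e) (proj₂ (present c′)))))

missing-colourʸ : ∀ {d a b} {G : BipGraph a b} {col : Labelling d a b} {x₀ y} →
  ProperColouring G col → deg G (inj₂ y) ≤ d → G x₀ y ≡ true → col x₀ y ≡ nothing →
  ∃ λ c → ∀ x → col x y ≢ just c
missing-colourʸ proper = missing-colourˣ (flip-proper proper)

-- The orbit of x₀ under a partial injection of Fin n that misses x₀ is a finite path.
module Orbit {n} (f : Fin n → Maybe (Fin n))
  (f-injective : ∀ {x x′ u} → f x ≡ just u → f x′ ≡ just u → x ≡ x′)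
  (x₀ : Fin n) (x₀∉image : ∀ x → f x ≢ just x₀) where

  orbit : ℕ → Maybe (Fin n)
  orbit zero    = just x₀
  orbit (suc k) = orbit k >>= f

  orbit-suc : ∀ k {x} → orbit k ≡ just x → orbit (suc k) ≡ f x
  orbit-suc k e rewrite e = refl

  orbit-pred : ∀ {k u} → orbit (suc k) ≡ just u → ∃ λ x → orbit k ≡ just x × f x ≡ just u
  orbit-pred {k} e with orbit k | e
  ... | just x  | fx≡u = x , refl , fx≡u
  ... | nothing | ()

  orbit-injective : ∀ {i j u} → orbit i ≡ just u → orbit j ≡ just u → i ≡ j
  orbit-injective {zero}  {zero}  _    _ = refl
  orbit-injective {zero}  {suc j} refl e = ⊥-elim (x₀∉image _ (proj₂ (proj₂ (orbit-pred {j} e))))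
  orbit-injective {suc i} {zero}  e refl = ⊥-elim (x₀∉image _ (proj₂ (proj₂ (orbit-pred {i} e))))
  orbit-injective {suc i} {suc j} e e′ with orbit-pred {i} e | orbit-pred {j} e′
  ... | x , ex , fx | x′ , ex′ , fx′ rewrite f-injective fx fx′ = cong suc (orbit-injective ex ex′)

  orbit-downward : ∀ {i j w} → i ≤ j → orbit j ≡ just w → ∃ λ v → orbit i ≡ just v
  orbit-downward {j = zero}  z≤n e = _ , e
  orbit-downward {j = suc j} i≤j e with m≤n⇒m<n∨m≡n i≤j
  ... | inj₂ refl       = _ , e
  ... | inj₁ (s≤s i≤j′) = orbit-downward i≤j′ (proj₁ (proj₂ (orbit-pred {j} e)))

  orbit-ends : orbit (suc n) ≡ nothing
  orbit-ends with orbit (suc n) in e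
  ... | nothing = refl
  ... | just w  = ⊥-elim (1+n≰n (FP.injective⇒≤ g-injective))
    where
    g : Fin (suc n) → Fin n
    g k = proj₁ (orbit-downward (<⇒≤ (FP.toℕ<n k)) e)
    g-injective : Injective _≡_ _≡_ g
    g-injective {k} {k′} gk≡gk′ = FP.toℕ-injective (orbit-injective
      (proj₂ (orbit-downward (<⇒≤ (FP.toℕ<n k)) e))
      (trans (proj₂ (orbit-downward (<⇒≤ (FP.toℕ<n k′)) e)) (cong just (sym gk≡gk′))))

  -- by orbit-ends the bound k ≤ n loses nothing, and it makes membership decidable
  InOrbit : Fin n → Set
  InOrbit x = ∃ λ (k : Fin (suc n)) → orbit (toℕ k) ≡ just x

  inOrbit? : ∀ x → Dec (InOrbit x)
  inOrbit? x = FP.any? λ k → orbit (toℕ k) ≟ᴹ just x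

  x₀∈orbit : InOrbit x₀
  x₀∈orbit = F.zero , refl

  orbit-closed : ∀ {x u} → InOrbit x → f x ≡ just u → InOrbit u
  orbit-closed {x} {u} (k , e) fx≡u with m≤n⇒m<n∨m≡n (s≤s⁻¹ (FP.toℕ<n k))
  ... | inj₁ k<n = fromℕ< (s≤s k<n) , trans (cong orbit (FP.toℕ-fromℕ< (s≤s k<n))) next
    where
    next : orbit (suc (toℕ k)) ≡ just u
    next = trans (orbit-suc (toℕ k) e) fx≡u
  ... | inj₂ k≡n with trans (sym orbit-ends) (trans (cong (orbit ∘ suc) (sym k≡n)) (trans (orbit-suc (toℕ k) e) fx≡u))
  ...   | ()

  orbit-predecessor : ∀ {u} → InOrbit u → u ≢ x₀ → ∃ λ x → InOrbit x × f x ≡ just u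
  orbit-predecessor (F.zero  , refl) u≢x₀ = ⊥-elim (u≢x₀ refl)
  orbit-predecessor (F.suc k , e)    u≢x₀ with orbit-pred {toℕ k} e
  ... | x , ex , fx≡u = x , (F.inject₁ k , trans (cong orbit (FP.toℕ-inject₁ k)) ex) , fx≡u

witness : ∀ {n} {P : Fin n → Set} → Dec (∃ P) → Maybe (Fin n)
witness (yes (i , _)) = just i
witness (no _)        = nothing

witness-sound : ∀ {n} {P : Fin n → Set} (P? : Dec (∃ P)) {i} → witness P? ≡ just i → P i
witness-sound (yes (i , Pi)) refl = Pi

witness-unique : ∀ {n} {P : Fin n → Set} (P? : Dec (∃ P)) {i} → P i → (∀ {j} → P j → j ≡ i) →
  witness P? ≡ just i
witness-unique (yes (j , Pj)) Pi unique = cong just (unique Pj)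
witness-unique (no ¬∃P)       Pi unique = ⊥-elim (¬∃P (_ , Pi))

transpose-matchˡ : (i j : Fin n) → transpose i j i ≡ j
transpose-matchˡ i j with i FP.≟ i
... | yes _   = refl
... | no i≢i = ⊥-elim (i≢i refl)

transpose-cases : (i j k : Fin n) →
  (k ≡ i × transpose i j k ≡ j) ⊎ (k ≡ j × transpose i j k ≡ i) ⊎ transpose i j k ≡ k
transpose-cases i j k with k FP.≟ i
... | yes k≡i = inj₁ (k≡i , refl)
... | no _ with k FP.≟ j
...   | yes k≡j = inj₂ (inj₁ (k≡j , refl))
...   | no _    = inj₂ (inj₂ refl)

-- Swapping α and β at the X-vertices of the α/β-alternating path from x₀ frees β at x₀
-- without using it at y₀, so the edge x₀y₀ can then be coloured β.
module KempeChain {d a b} {G : BipGraph a b} {col : Labelling d a b} (proper : ProperColouring G col)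
  {x₀ : Fin a} {y₀ : Fin b} (edge : G x₀ y₀ ≡ true) (uncoloured : col x₀ y₀ ≡ nothing)
  {α β : Fin d} (α∉x₀ : ∀ y → col x₀ y ≢ just α) (β∉y₀ : ∀ x → col x y₀ ≢ just β) where

  open ProperColouring proper

  β-edge? : ∀ x → Dec (∃ λ y → col x y ≡ just β)
  β-edge? x = FP.any? λ y → col x y ≟ᴹ just β

  α-edge? : ∀ y → Dec (∃ λ u → col u y ≡ just α)
  α-edge? y = FP.any? λ u → col u y ≟ᴹ just α

  step : Fin a → Maybe (Fin a)
  step x = witness (β-edge? x) >>= λ y → witness (α-edge? y)

  step-sound : ∀ {x u} → step x ≡ just u → ∃ λ y → col x y ≡ just β × col u y ≡ just α
  step-sound {x} e with witness (β-edge? x) in xy | e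
  ... | just y  | yu = y , witness-sound (β-edge? x) xy , witness-sound (α-edge? y) yu
  ... | nothing | ()

  step-complete : ∀ {x y u} → col x y ≡ just β → col u y ≡ just α → step x ≡ just u
  step-complete {x} {y} xy uy
    rewrite witness-unique (β-edge? x) xy (λ xy′ → injectiveˣ xy′ xy)
    = witness-unique (α-edge? y) uy (λ u′y → injectiveʸ u′y uy)

  step-injective : ∀ {x x′ u} → step x ≡ just u → step x′ ≡ just u → x ≡ x′
  step-injective e e′ with step-sound e | step-sound e′
  ... | y , xy , uy | y′ , x′y′ , uy′ rewrite injectiveˣ uy uy′ = injectiveʸ xy x′y′

  x₀∉image : ∀ x → step x ≢ just x₀
  x₀∉image x e = α∉x₀ _ (proj₂ (proj₂ (step-sound e)))

  open Orbit step step-injective x₀ x₀∉image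

  α-edge⇒predecessor : ∀ {x y} → InOrbit x → col x y ≡ just α → ∃ λ p → InOrbit p × col p y ≡ just β
  α-edge⇒predecessor {x} x∈O xy with orbit-predecessor x∈O (λ { refl → α∉x₀ _ xy })
  ... | p , p∈O , px with step-sound px
  ...   | y′ , py′ , xy′ rewrite injectiveˣ xy xy′ = p , p∈O , py′

  recoloured : Labelling d a b
  recoloured x y with inOrbit? x
  ... | yes _ = Data.Maybe.map (transpose α β) (col x y)
  ... | no _  = col x y

  recoloured-cases : ∀ {x y c} → recoloured x y ≡ just c →
    (InOrbit x × col x y ≡ just (transpose β α c)) ⊎ (¬ InOrbit x × col x y ≡ just c)
  recoloured-cases {x} {y} e with inOrbit? x
  ... | no x∉O = inj₂ (x∉O , e)
  ... | yes x∈O with col x y | e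
  ...   | just c | refl = inj₁ (x∈O , cong just (sym (transpose-inverse β α)))

  recoloured-keeps : ∀ {x y} → Coloured col x y → Coloured recoloured x y
  recoloured-keeps {x} {y} (c , xy) with inOrbit? x
  ... | yes _ rewrite xy = transpose α β c , refl
  ... | no _  = c , xy

  crossing-impossible : ∀ {x x′ y c} → InOrbit x → ¬ InOrbit x′ →
    col x y ≡ just (transpose β α c) → col x′ y ≡ just c → ⊥
  crossing-impossible {x} {x′} {y} {c} x∈O x′∉O xy x′y with transpose-cases β α c
  ... | inj₁ (refl , t≡α) with α-edge⇒predecessor x∈O (trans xy (cong just t≡α))
  ...   | p , p∈O , py = x′∉O (subst InOrbit (injectiveʸ py x′y) p∈O)
  crossing-impossible x∈O x′∉O xy x′y | inj₂ (inj₁ (refl , t≡β)) =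
    x′∉O (orbit-closed x∈O (step-complete (trans xy (cong just t≡β)) x′y))
  crossing-impossible x∈O x′∉O xy x′y | inj₂ (inj₂ t≡c) with injectiveʸ (trans xy (cong just t≡c)) x′y
  ... | refl = x′∉O x∈O

  recoloured-proper : ProperColouring G recoloured
  recoloured-proper = record { coloured⇒edge = edge′ ; injectiveˣ = injˣ ; injectiveʸ = injʸ }
    where
    edge′ : ∀ {x y c} → recoloured x y ≡ just c → G x y ≡ true
    edge′ e with recoloured-cases e
    ... | inj₁ (_ , xy) = coloured⇒edge xy
    ... | inj₂ (_ , xy) = coloured⇒edge xy
    injˣ : ∀ {x y y′ c} → recoloured x y ≡ just c → recoloured x y′ ≡ just c → y ≡ y′
    injˣ e e′ with recoloured-cases e | recoloured-cases e′
    ... | inj₁ (_ , xy)   | inj₁ (_ , xy′)   = injectiveˣ xy xy′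
    ... | inj₂ (_ , xy)   | inj₂ (_ , xy′)   = injectiveˣ xy xy′
    ... | inj₁ (x∈O , _)  | inj₂ (x∉O , _)   = ⊥-elim (x∉O x∈O)
    ... | inj₂ (x∉O , _)  | inj₁ (x∈O , _)   = ⊥-elim (x∉O x∈O)
    injʸ : ∀ {x x′ y c} → recoloured x y ≡ just c → recoloured x′ y ≡ just c → x ≡ x′
    injʸ e e′ with recoloured-cases e | recoloured-cases e′
    ... | inj₁ (_ , xy)    | inj₁ (_ , x′y)    = injectiveʸ xy x′y
    ... | inj₂ (_ , xy)    | inj₂ (_ , x′y)    = injectiveʸ xy x′y
    ... | inj₁ (x∈O , xy)  | inj₂ (x′∉O , x′y) = ⊥-elim (crossing-impossible x∈O x′∉O xy x′y)
    ... | inj₂ (x∉O , xy)  | inj₁ (x′∈O , x′y) = ⊥-elim (crossing-impossible x′∈O x∉O x′y xy)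

  β∉x₀-recoloured : ∀ y → recoloured x₀ y ≢ just β
  β∉x₀-recoloured y e with recoloured-cases e
  ... | inj₁ (_ , x₀y)   = α∉x₀ y (trans x₀y (cong just (transpose-matchˡ β α)))
  ... | inj₂ (x₀∉O , _) = x₀∉O x₀∈orbit

  β∉y₀-recoloured : ∀ x → recoloured x y₀ ≢ just β
  β∉y₀-recoloured x e with recoloured-cases e
  ... | inj₂ (_ , xy₀) = β∉y₀ x xy₀
  ... | inj₁ (x∈O , xy₀) with α-edge⇒predecessor x∈O (trans xy₀ (cong just (transpose-matchˡ β α)))
  ...   | p , _ , py₀ = β∉y₀ p py₀

  extended : Labelling d a b
  extended x y with x FP.≟ x₀ | y FP.≟ y₀
  ... | yes _ | yes _ = just β
  ... | _     | _     = recoloured x y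

  extended-cases : ∀ {x y c} → extended x y ≡ just c → (x ≡ x₀ × y ≡ y₀ × c ≡ β) ⊎ recoloured x y ≡ just c
  extended-cases {x} {y} e with x FP.≟ x₀ | y FP.≟ y₀
  ... | yes x≡x₀ | yes y≡y₀ = inj₁ (x≡x₀ , y≡y₀ , sym (just-injective e))
  ... | yes _    | no _     = inj₂ e
  ... | no _     | _        = inj₂ e

  extended-x₀y₀ : Coloured extended x₀ y₀
  extended-x₀y₀ with x₀ FP.≟ x₀ | y₀ FP.≟ y₀
  ... | yes _   | yes _   = β , refl
  ... | no x≢x  | _       = ⊥-elim (x≢x refl)
  ... | yes _   | no y≢y  = ⊥-elim (y≢y refl)

  extended-keeps : ∀ {x y} → Coloured col x y → Coloured extended x y
  extended-keeps {x} {y} xy with x FP.≟ x₀ | y FP.≟ y₀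
  ... | yes _ | yes _ = β , refl
  ... | yes _ | no _  = recoloured-keeps xy
  ... | no _  | _     = recoloured-keeps xy

  extended-proper : ProperColouring G extended
  extended-proper = record
    { coloured⇒edge = λ {x} {y} → edge′ {x} {y}
    ; injectiveˣ    = λ {x} {y} {y′} → injˣ {x} {y} {y′}
    ; injectiveʸ    = λ {x} {x′} {y} → injʸ {x} {x′} {y}
    }
    where
    open ProperColouring recoloured-proper renaming
      (coloured⇒edge to r-edge; injectiveˣ to r-injectiveˣ; injectiveʸ to r-injectiveʸ)
    edge′ : ∀ {x y c} → extended x y ≡ just c → G x y ≡ true
    edge′ {x} {y} e with extended-cases {x} {y} e
    ... | inj₁ (refl , refl , _) = edge
    ... | inj₂ xy                = r-edge xy
    injˣ : ∀ {x y y′ c} → extended x y ≡ just c → extended x y′ ≡ just c → y ≡ y′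
    injˣ {x} {y} {y′} e e′ with extended-cases {x} {y} e | extended-cases {x} {y′} e′
    ... | inj₁ (_ , refl , _)    | inj₁ (_ , refl , _)    = refl
    ... | inj₁ (refl , _ , refl) | inj₂ x₀y′              = ⊥-elim (β∉x₀-recoloured _ x₀y′)
    ... | inj₂ x₀y               | inj₁ (refl , _ , refl) = ⊥-elim (β∉x₀-recoloured _ x₀y)
    ... | inj₂ xy                | inj₂ xy′               = r-injectiveˣ xy xy′
    injʸ : ∀ {x x′ y c} → extended x y ≡ just c → extended x′ y ≡ just c → x ≡ x′
    injʸ {x} {x′} {y} e e′ with extended-cases {x} {y} e | extended-cases {x′} {y} e′
    ... | inj₁ (refl , _ , _)    | inj₁ (refl , _ , _)    = refl
    ... | inj₁ (_ , refl , refl) | inj₂ x′y₀              = ⊥-elim (β∉y₀-recoloured _ x′y₀)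
    ... | inj₂ xy₀               | inj₁ (_ , refl , refl) = ⊥-elim (β∉y₀-recoloured _ xy₀)
    ... | inj₂ xy                | inj₂ x′y               = r-injectiveʸ xy x′y

extend-colouring : ∀ {d a b} {G : BipGraph a b} {col : Labelling d a b} {x₀ y₀} → Δ G ≤ d →
  ProperColouring G col → G x₀ y₀ ≡ true → col x₀ y₀ ≡ nothing →
  Σ (Labelling d a b) λ col′ → ProperColouring G col′ × Coloured col′ x₀ y₀ ×
    (∀ {x y} → Coloured col x y → Coloured col′ x y)
extend-colouring {G = G} {x₀ = x₀} {y₀} Δ≤d proper edge uncoloured
  with missing-colourˣ proper (≤-trans (deg≤Δ G (inj₁ x₀)) Δ≤d) edge uncoloured
     | missing-colourʸ proper (≤-trans (deg≤Δ G (inj₂ y₀)) Δ≤d) edge uncoloured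
... | α , α∉x₀ | β , β∉y₀ = extended , extended-proper , extended-x₀y₀ , extended-keeps
  where open KempeChain proper edge uncoloured α∉x₀ β∉y₀

colour-edge : ∀ {d a b} {G : BipGraph a b} {col : Labelling d a b} → Δ G ≤ d →
  ProperColouring G col → ∀ x₀ y₀ →
  Σ (Labelling d a b) λ col′ → ProperColouring G col′ × (G x₀ y₀ ≡ true → Coloured col′ x₀ y₀) ×
    (∀ {x y} → Coloured col x y → Coloured col′ x y)
colour-edge {G = G} {col} Δ≤d proper x₀ y₀ with col x₀ y₀ in x₀y₀
... | just c  = col , proper , (λ _ → c , x₀y₀) , λ xy → xy
... | nothing with G x₀ y₀ in edge
...   | false = col , proper , (λ ()) , λ xy → xy
...   | true with extend-colouring Δ≤d proper edge x₀y₀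
...     | col′ , proper′ , coloured , keeps = col′ , proper′ , (λ _ → coloured) , keeps

colour-edges : ∀ {d a b} {G : BipGraph a b} → Δ G ≤ d → (E : List (Fin a × Fin b)) →
  Σ (Labelling d a b) λ col → ProperColouring G col ×
    (∀ {x y} → (x , y) ∈ E → G x y ≡ true → Coloured col x y)
colour-edges Δ≤d [] = (λ _ _ → nothing) , empty-proper , λ ()
  where
  empty-proper : ProperColouring _ (λ _ _ → nothing)
  empty-proper = record { coloured⇒edge = λ () ; injectiveˣ = λ () ; injectiveʸ = λ () }
colour-edges Δ≤d ((x₀ , y₀) ∷ E) with colour-edges Δ≤d E
... | col , proper , covers with colour-edge Δ≤d proper x₀ y₀
...   | col′ , proper′ , covers-x₀y₀ , keeps = col′ , proper′ , λ
  { (here refl) edge → covers-x₀y₀ edge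
  ; (there xy∈E) edge → keeps (covers xy∈E edge) }

konig-edge-colouring : ∀ {d a b} (G : BipGraph a b) → Δ G ≤ d →
  Σ (Labelling d a b) λ col → ProperColouring G col × (∀ x y → G x y ≡ true → Coloured col x y)
konig-edge-colouring {a = a} {b} G Δ≤d with colour-edges Δ≤d (cartesianProduct (allFin a) (allFin b))
... | col , proper , covers = col , proper , λ x y → covers (∈-cartesianProduct⁺ (∈-allFin x) (∈-allFin y))

all-colours-at : ∀ {d a b} {G : BipGraph a b} {col : Labelling d a b} {y} →
  ProperColouring G col → (∀ x y → G x y ≡ true → Coloured col x y) →
  d ≤ deg G (inj₂ y) → ∀ c → ∃ λ x → col x y ≡ just c
all-colours-at {suc d} {G = G} {col} {y} proper total d≤deg c
  with FP.any? (λ x → col x y ≟ᴹ just c)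
... | yes found = found
... | no ¬found = ⊥-elim (1+n≰n (≤-trans d≤deg deg≤d))
  where
  open ProperColouring proper
  c≢colour : ∀ {x} (xy : G x y ≡ true) → c ≢ proj₁ (total x y xy)
  c≢colour {x} xy refl = ¬found (x , proj₂ (total x y xy))
  deg≤d : deg G (inj₂ y) ≤ d
  deg≤d = injective⇒count≤ (λ x xy → F.punchOut (c≢colour xy)) λ {x} {x′} xy x′y e →
    injectiveʸ (proj₂ (total x y xy))
      (trans (proj₂ (total x′ y x′y)) (cong just (sym (FP.punchOut-injective (c≢colour xy) (c≢colour x′y) e))))

-- Sorting by a key

injective⇒surjective : (f : Fin n → Fin n) → Injective _≡_ _≡_ f → ∀ j → ∃ λ i → f i ≡ j
injective⇒surjective {suc n} f f-injective j with FP.any? (λ i → f i FP.≟ j)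
... | yes hit = hit
... | no ¬hit = ⊥-elim (1+n≰n (FP.injective⇒≤ g-injective))
  where
  j≢f : ∀ i → j ≢ f i
  j≢f i j≡fi = ¬hit (i , sym j≡fi)
  g : Fin (suc n) → Fin n
  g i = F.punchOut (j≢f i)
  g-injective : Injective _≡_ _≡_ g
  g-injective e = f-injective (FP.punchOut-injective (j≢f _) (j≢f _) e)

permutation-between : (ρ ρ′ : Fin n → Fin n) → Injective _≡_ _≡_ ρ → Injective _≡_ _≡_ ρ′ →
  Σ (Fin n ↔ Fin n) λ π → ∀ x → ρ′ (Inverse.to π x) ≡ ρ x
permutation-between {n} ρ ρ′ ρ-injective ρ′-injective = mk↔ₛ′ π π⁻¹ π∘π⁻¹ π⁻¹∘π , ρ′∘π
  where
  π π⁻¹ : Fin n → Fin n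
  π   x = proj₁ (injective⇒surjective ρ′ ρ′-injective (ρ x))
  π⁻¹ x = proj₁ (injective⇒surjective ρ ρ-injective (ρ′ x))
  ρ′∘π : ∀ x → ρ′ (π x) ≡ ρ x
  ρ′∘π x = proj₂ (injective⇒surjective ρ′ ρ′-injective (ρ x))
  ρ∘π⁻¹ : ∀ x → ρ (π⁻¹ x) ≡ ρ′ x
  ρ∘π⁻¹ x = proj₂ (injective⇒surjective ρ ρ-injective (ρ′ x))
  π∘π⁻¹ : ∀ x → π (π⁻¹ x) ≡ x
  π∘π⁻¹ x = ρ′-injective (trans (ρ′∘π (π⁻¹ x)) (ρ∘π⁻¹ x))
  π⁻¹∘π : ∀ x → π⁻¹ (π x) ≡ x
  π⁻¹∘π x = ρ-injective (trans (ρ∘π⁻¹ (π x)) (ρ′∘π x))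

below : (Fin n → ℕ) → ℕ → ℕ
below κ k = count (λ x → κ x <ᵇ k)

fibre : (Fin n → ℕ) → ℕ → ℕ
fibre κ k = count (λ x → κ x ≡ᵇ k)

below-suc : (κ : Fin n → ℕ) (k : ℕ) → below κ (suc k) ≡ below κ k + fibre κ k
below-suc κ k = count-+ _ _ _ (λ x → split (κ x))
  where
  split : ∀ m → indicator (m <ᵇ suc k) ≡ indicator (m <ᵇ k) + indicator (m ≡ᵇ k)
  split m with <-cmp m k
  ... | tri< m<k m≢k _ rewrite <ᵇ-true m k m<k | <ᵇ-true m (suc k) (m<n⇒m<1+n m<k) | ≡ᵇ-false m k m≢k = refl
  ... | tri≈ _ refl _  rewrite <ᵇ-false m m ≤-refl | <ᵇ-true m (suc m) (n<1+n m) | ≡ᵇ-refl m = refl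
  ... | tri> _ m≢k k<m rewrite <ᵇ-false m k (<⇒≤ k<m) | <ᵇ-false m (suc k) k<m | ≡ᵇ-false m k m≢k = refl

below-mono : (κ : Fin n → ℕ) {k k′ : ℕ} → k ≤ k′ → below κ k ≤ below κ k′
below-mono κ {k} {k′} k≤k′ = count-mono {P = λ x → κ x <ᵇ k} {Q = λ x → κ x <ᵇ k′}
  (λ x e → <ᵇ-true _ _ (<-≤-trans (<ᵇ-true⁻¹ e) k≤k′))

below-all : (κ : Fin n → ℕ) {k : ℕ} → (∀ x → κ x < k) → below κ k ≡ n
below-all κ κ<k = count-≡n _ (λ x → <ᵇ-true _ _ (κ<k x))

-- The position of x when Fin n is sorted by the key κ, ties broken by index.
position : (Fin n → ℕ) → Fin n → ℕ
position κ x = below κ (κ x) + rank (λ x′ → κ x′ ≡ᵇ κ x) x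

below≤position : (κ : Fin n → ℕ) (x : Fin n) → below κ (κ x) ≤ position κ x
below≤position κ x = m≤m+n _ _

position<below : (κ : Fin n → ℕ) (x : Fin n) → position κ x < below κ (suc (κ x))
position<below κ x rewrite below-suc κ (κ x) =
  +-monoʳ-< (below κ (κ x)) (rank<count _ x (≡ᵇ-refl (κ x)))

position<n : (κ : Fin n → ℕ) (x : Fin n) → position κ x < n
position<n κ x = <-≤-trans (position<below κ x) (count≤n _)

position⇒key : (κ κ′ : Fin n → ℕ) → (∀ k → below κ k ≡ below κ′ k) →
  ∀ {x x′} → position κ x ≡ position κ′ x′ → κ x ≡ κ′ x′
position⇒key κ κ′ same-below {x} {x′} same-position with <-cmp (κ x) (κ′ x′)
... | tri≈ _ κx≡κ′x′ _ = κx≡κ′x′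
... | tri< κx<κ′x′ _ _ = ⊥-elim (<-irrefl same-position (begin-strict
  position κ x           <⟨ position<below κ x ⟩
  below κ (suc (κ x))    ≤⟨ below-mono κ κx<κ′x′ ⟩
  below κ (κ′ x′)        ≡⟨ same-below (κ′ x′) ⟩
  below κ′ (κ′ x′)       ≤⟨ below≤position κ′ x′ ⟩
  position κ′ x′         ∎))
  where open ≤-Reasoning
... | tri> _ _ κ′x′<κx = ⊥-elim (<-irrefl (sym same-position) (begin-strict
  position κ′ x′         <⟨ position<below κ′ x′ ⟩
  below κ′ (suc (κ′ x′)) ≤⟨ below-mono κ′ κ′x′<κx ⟩
  below κ′ (κ x)         ≡⟨ same-below (κ x) ⟨
  below κ (κ x)          ≤⟨ below≤position κ x ⟩
  position κ x           ∎))
  where open ≤-Reasoning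

position-injective : (κ : Fin n → ℕ) → ∀ {x x′} → position κ x ≡ position κ x′ → x ≡ x′
position-injective κ {x} {x′} same-position with position⇒key κ κ (λ _ → refl) same-position
... | κx≡κx′ = rank-injective _ (≡ᵇ-refl (κ x)) (trans (cong (κ x′ ≡ᵇ_) κx≡κx′) (≡ᵇ-refl (κ x′)))
  (+-cancelˡ-≡ (below κ (κ x)) _ _
    (trans same-position (cong (λ k → below κ k + rank (λ x″ → κ x″ ≡ᵇ k) x′) (sym κx≡κx′))))

sortedPosition : (Fin n → ℕ) → Fin n → Fin n
sortedPosition κ x = fromℕ< (position<n κ x)

sortedPosition-injective : (κ : Fin n → ℕ) → Injective _≡_ _≡_ (sortedPosition κ)
sortedPosition-injective κ e = position-injective κ (FP.fromℕ<-injective _ _ (position<n κ _) (position<n κ _) e)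

rearrangement : (κ κ′ : Fin n → ℕ) → (∀ k → below κ k ≡ below κ′ k) →
  Σ (Fin n ↔ Fin n) λ π → ∀ x → κ′ (Inverse.to π x) ≡ κ x
rearrangement κ κ′ same-below = π , λ x → sym (position⇒key κ κ′ same-below (sym (begin
  position κ′ (Inverse.to π x)                ≡⟨ FP.toℕ-fromℕ< (position<n κ′ _) ⟨
  toℕ (sortedPosition κ′ (Inverse.to π x))    ≡⟨ cong toℕ (ρ′∘π≡ρ x) ⟩
  toℕ (sortedPosition κ x)                    ≡⟨ FP.toℕ-fromℕ< (position<n κ x) ⟩
  position κ x                                ∎)))
  where
  open ≡-Reasoning
  between = permutation-between (sortedPosition κ) (sortedPosition κ′)
              (sortedPosition-injective κ) (sortedPosition-injective κ′)
  π = proj₁ between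
  ρ′∘π≡ρ = proj₂ between

-- Keys are bounded by c, so the fibre over c is n minus the others and need not be assumed equal.
below-≡ : (κ κ′ : Fin n → ℕ) (c : ℕ) → (∀ x → κ x ≤ c) → (∀ x → κ′ x ≤ c) →
  (∀ k → k < c → fibre κ k ≡ fibre κ′ k) → ∀ k → below κ k ≡ below κ′ k
below-≡ κ κ′ c κ≤c κ′≤c same-fibre k with k ≤? c
... | no k≰c = trans (below-all κ λ x → ≤-<-trans (κ≤c x) (≰⇒> k≰c))
                     (sym (below-all κ′ λ x → ≤-<-trans (κ′≤c x) (≰⇒> k≰c)))
... | yes k≤c = below-≡-≤ k k≤c
  where
  below-≡-≤ : ∀ k → k ≤ c → below κ k ≡ below κ′ k
  below-≡-≤ zero    _   = trans (count-≡0 _ λ x → <ᵇ-false (κ x) 0 z≤n) (sym (count-≡0 _ λ x → <ᵇ-false (κ′ x) 0 z≤n))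
  below-≡-≤ (suc k) k<c = begin
    below κ (suc k)          ≡⟨ below-suc κ k ⟩
    below κ k + fibre κ k    ≡⟨ cong₂ _+_ (below-≡-≤ k (<⇒≤ k<c)) (same-fibre k k<c) ⟩
    below κ′ k + fibre κ′ k  ≡⟨ below-suc κ′ k ⟨
    below κ′ (suc k)         ∎
    where open ≡-Reasoning

-- Graphs in which every x has at most one neighbour

AtMostOneNeighbour : ∀ {a b} → BipGraph a b → Set
AtMostOneNeighbour G = ∀ {x y y′} → G x y ≡ true → G x y′ ≡ true → y ≡ y′

-- the index of the neighbour of x, or b if x is isolated
neighbour : ∀ {a b} → BipGraph a b → Fin a → ℕ
neighbour {b = b} G x with FP.any? (λ y → G x y Data.Bool.≟ true)
... | yes (y , _) = toℕ y
... | no _        = b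

neighbour≤b : ∀ {a b} (G : BipGraph a b) (x : Fin a) → neighbour G x ≤ b
neighbour≤b G x with FP.any? (λ y → G x y Data.Bool.≟ true)
... | yes (y , _) = <⇒≤ (FP.toℕ<n y)
... | no _        = ≤-refl

neighbour-spec : ∀ {a b} (G : BipGraph a b) → AtMostOneNeighbour G →
  ∀ x y → G x y ≡ (neighbour G x ≡ᵇ toℕ y)
neighbour-spec {b = b} G unique x y with FP.any? (λ y → G x y Data.Bool.≟ true) | G x y in xy
... | yes (y′ , xy′) | true  rewrite unique xy xy′ = sym (≡ᵇ-refl (toℕ y′))
... | yes (y′ , xy′) | false = sym (≡ᵇ-false _ _ λ y′≡y →
  true≢false (trans (sym xy′) (trans (cong (G x) (FP.toℕ-injective y′≡y)) xy)))
  where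
  true≢false : true ≢ false
  true≢false ()
... | no no-neighbour | true  = ⊥-elim (no-neighbour (y , xy))
... | no _            | false = sym (≡ᵇ-false _ _ λ b≡y → <-irrefl (sym b≡y) (FP.toℕ<n y))

isomorphic-by-degreesʸ : ∀ {a b} (G G′ : BipGraph a b) → AtMostOneNeighbour G → AtMostOneNeighbour G′ →
  (∀ y → deg G (inj₂ y) ≡ deg G′ (inj₂ y)) → Isomorphic G G′
isomorphic-by-degreesʸ {a} {b} G G′ unique unique′ same-deg = σ , adjacency
  where
  open ≡-Reasoning
  same-fibre : ∀ k → k < b → fibre (neighbour G) k ≡ fibre (neighbour G′) k
  same-fibre k k<b = begin
    fibre (neighbour G) k         ≡⟨ cong (fibre (neighbour G)) (FP.toℕ-fromℕ< k<b) ⟨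
    fibre (neighbour G) (toℕ y)   ≡⟨ count-cong (λ x → neighbour-spec G unique x y) ⟨
    deg G (inj₂ y)                ≡⟨ same-deg y ⟩
    deg G′ (inj₂ y)               ≡⟨ count-cong (λ x → neighbour-spec G′ unique′ x y) ⟩
    fibre (neighbour G′) (toℕ y)  ≡⟨ cong (fibre (neighbour G′)) (FP.toℕ-fromℕ< k<b) ⟩
    fibre (neighbour G′) k        ∎
    where y = fromℕ< k<b
  rearranged = rearrangement (neighbour G) (neighbour G′)
    (below-≡ (neighbour G) (neighbour G′) b (neighbour≤b G) (neighbour≤b G′) same-fibre)
  π = proj₁ rearranged
  edges : ∀ x y → G x y ≡ G′ (Inverse.to π x) y
  edges x y = begin
    G x y                                    ≡⟨ neighbour-spec G unique x y ⟩
    (neighbour G x ≡ᵇ toℕ y)                 ≡⟨ cong (_≡ᵇ toℕ y) (proj₂ rearranged x) ⟨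
    (neighbour G′ (Inverse.to π x) ≡ᵇ toℕ y) ≡⟨ neighbour-spec G′ unique′ (Inverse.to π x) y ⟨
    G′ (Inverse.to π x) y                    ∎
  σ : V a b ↔ V a b
  σ = π ⊎-↔ ↔-id (Fin b)
  adjacency : ∀ u v → Adj G u v ≡ Adj G′ (Inverse.to σ u) (Inverse.to σ v)
  adjacency (inj₁ x) (inj₁ x′) = refl
  adjacency (inj₁ x) (inj₂ y)  = edges x y
  adjacency (inj₂ y) (inj₁ x)  = edges x y
  adjacency (inj₂ y) (inj₂ y′) = refl

part⁻ : ∀ {d a b} {G : BipGraph a b} {col : Labelling d a b} {c x y} →
  part G col c x y ≡ true → G x y ≡ true × col x y ≡ c
part⁻ {G = G} {col} {c} {x} {y} e with G x y | col x y ≟ᴹ c | e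
... | true  | yes xy≡c | _  = refl , xy≡c
... | true  | no _     | ()
... | false | _        | ()

part⁺ : ∀ {d a b} {G : BipGraph a b} {col : Labelling d a b} {c x y} →
  G x y ≡ true → col x y ≡ c → part G col c x y ≡ true
part⁺ {G = G} {col} {c} {x} {y} xy xy≡c with col x y ≟ᴹ c
... | yes _     rewrite xy = refl
... | no xy≢c = ⊥-elim (xy≢c xy≡c)

star-forest-centred-in-Y : ∀ {a b} (G : BipGraph a b) {d D : ℕ} → AtMostOneNeighbour G →
  (∀ y → d * deg G (inj₂ y) ≤ D) → StarForestBounded G b d D
star-forest-centred-in-Y {a} {b} G {d} {D} unique small = centre , (one-centre , leaves) , few , small′
  where
  centre : V a b → Bool
  centre (inj₁ _) = false
  centre (inj₂ _) = true
  one-centre : ∀ x y → G x y ≡ true → (centre (inj₁ x) Data.Bool.xor centre (inj₂ y)) ≡ true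
  one-centre x y _ = refl
  leaves : ∀ v → centre v ≡ false → deg G v ≤ 1
  leaves (inj₁ x) _ = injective⇒count≤ (λ _ _ → F.zero) (λ xy xy′ _ → unique xy xy′)
  few : numStars G centre ≤ b
  few rewrite count-≡0 {a} (λ _ → false) (λ _ → refl) = count≤n _
  small′ : ∀ v → centre v ≡ true → d * deg G v ≤ D
  small′ (inj₂ y) _ = small y

-- Splitting the vertices of Y

[m+k*n]/n≡k : ∀ m k n .{{_ : NonZero n}} → m < n → (m + k * n) / n ≡ k
[m+k*n]/n≡k m k n m<n = begin
  (m + k * n) / n      ≡⟨ +-distrib-/-∣ʳ m (divides-refl k) ⟩
  m / n + k * n / n    ≡⟨ cong₂ _+_ (m<n⇒m/n≡0 m<n) (m*n/n≡m k n) ⟩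
  k                    ∎
  where open ≡-Reasoning

-- The new vertex for the k-th block of y is F.combine y k : Fin (b * a).
module Splitting (d : ℕ) .{{_ : NonZero d}} {a b : ℕ} (H : BipGraph a b) where

  rk : Fin a → Fin b → ℕ
  rk x y = rank (λ x′ → H x′ y) x

  block : Fin a → Fin b → ℕ
  block x y = rk x y / d

  blocks : Fin b → ℕ
  blocks y = deg H (inj₂ y) / d

  Full : BipGraph a b
  Full x y = H x y ∧ (rk x y <ᵇ blocks y * d)

  origin : Fin (b * a) → Fin b
  origin = F.quotient {b} a

  index : Fin (b * a) → Fin a
  index = F.remainder {b} a

  Split : BipGraph a (b * a)
  Split x z = Full x (origin z) ∧ (block x (origin z) ≡ᵇ toℕ (index z))

  block<a : ∀ x y → block x y < a
  block<a x y = ≤-<-trans (m/n≤m (rk x y) d) (rank<n _ x)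

  node : Fin a → Fin b → Fin (b * a)
  node x y = F.combine y (fromℕ< (block<a x y))

  origin-combine : ∀ y (k : Fin a) → origin (F.combine y k) ≡ y
  origin-combine y k = cong proj₁ (FP.remQuot-combine {b} {a} y k)

  index-combine : ∀ y (k : Fin a) → index (F.combine y k) ≡ k
  index-combine y k = cong proj₂ (FP.remQuot-combine {b} {a} y k)

  Split-combine : ∀ x y k → Split x (F.combine y k) ≡ Full x y ∧ (block x y ≡ᵇ toℕ k)
  Split-combine x y k =
    cong₂ (λ y′ k′ → Full x y′ ∧ (block x y′ ≡ᵇ toℕ k′)) (origin-combine y k) (index-combine y k)

  Split-node : ∀ x y → Split x (node x y) ≡ Full x y
  Split-node x y = begin
    Split x (node x y)                                          ≡⟨ Split-combine x y _ ⟩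
    Full x y ∧ (block x y ≡ᵇ toℕ (fromℕ< (block<a x y)))       ≡⟨ cong (λ k → Full x y ∧ (block x y ≡ᵇ k)) (FP.toℕ-fromℕ< _) ⟩
    Full x y ∧ (block x y ≡ᵇ block x y)                         ≡⟨ cong (Full x y ∧_) (≡ᵇ-refl (block x y)) ⟩
    Full x y ∧ true                                             ≡⟨ ∧-identityʳ (Full x y) ⟩
    Full x y                                                    ∎
    where open ≡-Reasoning

  Split⇒Full : ∀ {x z} → Split x z ≡ true → Full x (origin z) ≡ true
  Split⇒Full {x} {z} e with Full x (origin z)
  ... | true = refl

  Split⇒block : ∀ {x z} → Split x z ≡ true → block x (origin z) ≡ toℕ (index z)
  Split⇒block {x} {z} e with Full x (origin z)
  ... | true = ≡ᵇ-true⁻¹ e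

  Split⇒node : ∀ {x z} → Split x z ≡ true → node x (origin z) ≡ z
  Split⇒node {x} {z} e = begin
    F.combine (origin z) (fromℕ< (block<a x (origin z)))
      ≡⟨ cong (F.combine (origin z)) (FP.toℕ-injective (trans (FP.toℕ-fromℕ< _) (Split⇒block e))) ⟩
    F.combine (origin z) (index z)
      ≡⟨ FP.combine-remQuot {b} a z ⟩
    z ∎
    where open ≡-Reasoning

  Split-combine⇒block : ∀ {x y k} → Split x (F.combine y k) ≡ true → block x y ≡ toℕ k
  Split-combine⇒block {x} {y} {k} e = begin
    block x y                                  ≡⟨ cong (block x) (origin-combine y k) ⟨
    block x (origin (F.combine y k))           ≡⟨ Split⇒block e ⟩
    toℕ (index (F.combine y k))                ≡⟨ cong toℕ (index-combine y k) ⟩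
    toℕ k                                      ∎
    where open ≡-Reasoning

  node-≡ : ∀ {x y k} → block x y ≡ toℕ k → node x y ≡ F.combine y k
  node-≡ {x} {y} block≡k = cong (F.combine y) (FP.toℕ-injective (trans (FP.toℕ-fromℕ< (block<a x y)) block≡k))

  Full⇒edge : ∀ {x y} → Full x y ≡ true → H x y ≡ true
  Full⇒edge {x} {y} e with H x y
  ... | true = refl

  Full⇒block< : ∀ {x y} → Full x y ≡ true → block x y < blocks y
  Full⇒block< {x} {y} e with H x y
  ... | true = m<n*o⇒m/o<n (<ᵇ-true⁻¹ e)

  blocks≤a : ∀ y → blocks y ≤ a
  blocks≤a y = ≤-trans (m/n≤m _ d) (count≤n _)

  degˣ-Split : ∀ x → deg Split (inj₁ x) ≤ deg H (inj₁ x)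
  degˣ-Split x = count-≤-injection (λ z _ → origin z) (λ z e → Full⇒edge (Split⇒Full e))
    (λ e e′ same-origin → trans (sym (Split⇒node e)) (trans (cong (node x) same-origin) (Split⇒node e′)))

  rk-injective : ∀ {x x′ y} → H x y ≡ true → H x′ y ≡ true →
    rk x y % d ≡ rk x′ y % d → block x y ≡ block x′ y → x ≡ x′
  rk-injective {x} {x′} {y} xy x′y same-mod same-block = rank-injective _ xy x′y (begin
    rk x y                         ≡⟨ m≡m%n+[m/n]*n (rk x y) d ⟩
    rk x y % d + block x y * d     ≡⟨ cong₂ (λ r q → r + q * d) same-mod same-block ⟩
    rk x′ y % d + block x′ y * d   ≡⟨ m≡m%n+[m/n]*n (rk x′ y) d ⟨
    rk x′ y                        ∎)
    where open ≡-Reasoning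

  degʸ-Split : ∀ z → deg Split (inj₂ z) ≤ d
  degʸ-Split z = injective⇒count≤ (λ x _ → fromℕ< (m%n<n (rk x (origin z)) d)) λ e e′ same-mod →
    rk-injective (Full⇒edge (Split⇒Full e)) (Full⇒edge (Split⇒Full e′))
      (FP.fromℕ<-injective _ _ (m%n<n _ d) (m%n<n _ d) same-mod)
      (trans (Split⇒block e) (sym (Split⇒block e′)))

  Δ-Split≤ : (∀ x → deg H (inj₁ x) ≤ d) → Δ Split ≤ d
  Δ-Split≤ degˣ≤d = s≤s⁻¹ (Δ< Split (s≤s z≤n) deg-Split<1+d)
    where
    deg-Split<1+d : ∀ v → deg Split v < suc d
    deg-Split<1+d (inj₁ x) = s≤s (≤-trans (degˣ-Split x) (degˣ≤d x))
    deg-Split<1+d (inj₂ z) = s≤s (degʸ-Split z)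

  module Block (y : Fin b) (k : Fin a) (k<blocks : toℕ k < blocks y) where

    rank<blocks*d : (p : Fin d) → toℕ p + toℕ k * d < blocks y * d
    rank<blocks*d p = <-≤-trans (+-monoˡ-< (toℕ k * d) (FP.toℕ<n p)) (*-monoˡ-≤ d k<blocks)

    member-position : Fin d → Fin (deg H (inj₂ y))
    member-position p = fromℕ< (<-≤-trans (rank<blocks*d p) (m/n*n≤m _ d))

    member : Fin d → Fin a
    member p = enum (λ x → H x y) (member-position p)

    rk-member : ∀ p → rk (member p) y ≡ toℕ p + toℕ k * d
    rk-member p = trans (rank-enum (λ x → H x y) (member-position p)) (FP.toℕ-fromℕ< _)

    member-Split : ∀ p → Split (member p) (F.combine y k) ≡ true
    member-Split p = begin
      Split (member p) (F.combine y k)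
        ≡⟨ Split-combine (member p) y k ⟩
      (H (member p) y ∧ (rk (member p) y <ᵇ blocks y * d)) ∧ (rk (member p) y / d ≡ᵇ toℕ k)
        ≡⟨ cong₂ (λ h r → (h ∧ (r <ᵇ blocks y * d)) ∧ (r / d ≡ᵇ toℕ k)) (enum-∈ (λ x → H x y) (member-position p)) (rk-member p) ⟩
      (toℕ p + toℕ k * d <ᵇ blocks y * d) ∧ ((toℕ p + toℕ k * d) / d ≡ᵇ toℕ k)
        ≡⟨ cong₂ _∧_ (<ᵇ-true _ _ (rank<blocks*d p)) (cong (_≡ᵇ toℕ k) ([m+k*n]/n≡k (toℕ p) (toℕ k) d (FP.toℕ<n p))) ⟩
      true ∧ (toℕ k ≡ᵇ toℕ k)
        ≡⟨ ≡ᵇ-refl (toℕ k) ⟩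
      true ∎
      where open ≡-Reasoning

    member-injective : Injective _≡_ _≡_ member
    member-injective {p} {p′} e = FP.toℕ-injective (+-cancelʳ-≡ _ (toℕ p) (toℕ p′)
      (trans (sym (rk-member p)) (trans (cong (λ x → rk x y) e) (rk-member p′))))

    d≤degʸ-Split : d ≤ deg Split (inj₂ (F.combine y k))
    d≤degʸ-Split = injective⇒≤count member member-injective member-Split

module BlockColouring (d : ℕ) .{{_ : NonZero d}} {a b : ℕ} (H : BipGraph a b)
  (splitCol : Labelling d a (b * a)) (proper : ProperColouring (Splitting.Split d H) splitCol)
  (total : ∀ x z → Splitting.Split d H x z ≡ true → Coloured splitCol x z) where

  open Splitting d H
  open ProperColouring proper

  colouring : Labelling d a b
  colouring x y = splitCol x (node x y)

  colouring⇒Full : ∀ {x y c} → colouring x y ≡ just c → Full x y ≡ true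
  colouring⇒Full {x} {y} e = trans (sym (Split-node x y)) (coloured⇒edge e)

  Full⇒coloured : ∀ {x y} → Full x y ≡ true → Coloured colouring x y
  Full⇒coloured {x} {y} full = total x (node x y) (trans (Split-node x y) full)

  Class : Fin d → BipGraph a b
  Class c = part H colouring (just c)

  Rest : BipGraph a b
  Rest = part H colouring nothing

  Class⁻ : ∀ c {x y} → Class c x y ≡ true → colouring x y ≡ just c
  Class⁻ c {x} {y} e = proj₂ (part⁻ {G = H} {colouring} {just c} {x} {y} e)

  Class-block< : ∀ c {x y} → Class c x y ≡ true → block x y < blocks y
  Class-block< c {x} {y} e = Full⇒block< {x} {y} (colouring⇒Full {x} {y} (Class⁻ c e))

  class-at-most-one : ∀ c → AtMostOneNeighbour (Class c)
  class-at-most-one c {x} {y} {y′} e e′ = begin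
    y                   ≡⟨ origin-combine y _ ⟨
    origin (node x y)   ≡⟨ cong origin (injectiveˣ (Class⁻ c e) (Class⁻ c e′)) ⟩
    origin (node x y′)  ≡⟨ origin-combine y′ _ ⟩
    y′                  ∎
    where open ≡-Reasoning

  degʸ-Class≤blocks : ∀ c y → deg (Class c) (inj₂ y) ≤ blocks y
  degʸ-Class≤blocks c y = injective⇒count≤ (λ x e → fromℕ< (Class-block< c e)) same-block⇒same
    where
    same-block⇒same : ∀ {x x′} e e′ → fromℕ< (Class-block< c {x} e) ≡ fromℕ< (Class-block< c {x′} e′) → x ≡ x′
    same-block⇒same {x} {x′} e e′ same = injectiveʸ (Class⁻ c e) (begin
      splitCol x′ (node x y)    ≡⟨ cong (splitCol x′) (node-≡ {x} {y} (trans block≡ (sym (FP.toℕ-fromℕ< (block<a x′ y))))) ⟩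
      splitCol x′ (node x′ y)   ≡⟨ Class⁻ c e′ ⟩
      just c                    ∎)
      where
      open ≡-Reasoning
      block≡ : block x y ≡ block x′ y
      block≡ = FP.fromℕ<-injective _ _ (Class-block< c e) (Class-block< c e′) same

  blocks≤degʸ-Class : ∀ c y → blocks y ≤ deg (Class c) (inj₂ y)
  blocks≤degʸ-Class c y = injective⇒≤count found found-injective found∈Class
    where
    index< : (j : Fin (blocks y)) → toℕ j < a
    index< j = <-≤-trans (FP.toℕ<n j) (blocks≤a y)
    block-vertex : Fin (blocks y) → Fin a
    block-vertex j = fromℕ< (index< j)
    block-vertex< : ∀ j → toℕ (block-vertex j) < blocks y
    block-vertex< j = subst (_< blocks y) (sym (FP.toℕ-fromℕ< (index< j))) (FP.toℕ<n j)
    present : ∀ j → ∃ λ x → splitCol x (F.combine y (block-vertex j)) ≡ just c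
    present j = all-colours-at proper total (Block.d≤degʸ-Split y (block-vertex j) (block-vertex< j)) c
    found : Fin (blocks y) → Fin a
    found j = proj₁ (present j)
    found-block : ∀ j → block (found j) y ≡ toℕ (block-vertex j)
    found-block j = Split-combine⇒block {found j} {y} (coloured⇒edge (proj₂ (present j)))
    found∈Class : ∀ j → Class c (found j) y ≡ true
    found∈Class j = part⁺ {G = H} {colouring} {just c} {found j} {y}
      (Full⇒edge {found j} {y} (colouring⇒Full {found j} {y} coloured)) coloured
      where
      coloured : colouring (found j) y ≡ just c
      coloured = trans (cong (splitCol (found j)) (node-≡ {found j} {y} (found-block j))) (proj₂ (present j))
    found-injective : Injective _≡_ _≡_ found
    found-injective {j} {j′} e = FP.toℕ-injective (begin
      toℕ j                       ≡⟨ FP.toℕ-fromℕ< (index< j) ⟨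
      toℕ (block-vertex j)        ≡⟨ found-block j ⟨
      block (found j) y           ≡⟨ cong (λ x → block x y) e ⟩
      block (found j′) y          ≡⟨ found-block j′ ⟩
      toℕ (block-vertex j′)       ≡⟨ FP.toℕ-fromℕ< (index< j′) ⟩
      toℕ j′                      ∎)
      where open ≡-Reasoning

  degʸ-Class : ∀ c y → deg (Class c) (inj₂ y) ≡ blocks y
  degʸ-Class c y = ≤-antisym (degʸ-Class≤blocks c y) (blocks≤degʸ-Class c y)

  Rest⇒not-Full : ∀ {x y} → Rest x y ≡ true → (H x y ∧ not (rk x y <ᵇ blocks y * d)) ≡ true
  Rest⇒not-Full {x} {y} e with part⁻ {G = H} {colouring} {nothing} {x} {y} e
  ... | xy , uncoloured with rk x y <ᵇ blocks y * d in short
  ...   | false rewrite xy = refl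
  ...   | true with Full⇒coloured {x} {y} (trans (cong (_∧ (rk x y <ᵇ blocks y * d)) xy) short)
  ...     | c , coloured with trans (sym uncoloured) coloured
  ...       | ()

  degʸ-Rest : ∀ y → deg Rest (inj₂ y) < d
  degʸ-Rest y = begin-strict
    deg Rest (inj₂ y)                                          ≤⟨ count-mono {P = λ x → Rest x y} (λ x → Rest⇒not-Full {x} {y}) ⟩
    count (λ x → H x y ∧ not (rk x y <ᵇ blocks y * d))        ≡⟨ count-rank≥ (λ x → H x y) (blocks y * d) ⟩
    deg H (inj₂ y) ∸ blocks y * d                              ≡⟨ m%n≡m∸m/n*n (deg H (inj₂ y)) d ⟨
    deg H (inj₂ y) % d                                         <⟨ m%n<n _ d ⟩
    d                                                          ∎
    where open ≤-Reasoning

  degˣ-Rest≤ : ∀ x → deg Rest (inj₁ x) ≤ deg H (inj₁ x)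
  degˣ-Rest≤ x = count-mono {P = Rest x} {Q = H x} (λ y e → proj₁ (part⁻ {G = H} {colouring} {nothing} {x} {y} e))

lemma3p4 : (d a b : ℕ) → 1 ≤ d → (H : BipGraph a b) →
    (∀ x → deg H (inj₁ x) < d) →
    Σ (Labelling d a b) λ col →
      (∀ i j → Isomorphic (part H col (just i)) (part H col (just j))) ×
      (∀ i → StarForestBounded (part H col (just i)) b d (Δ H)) ×
      Δ (part H col nothing) < d
lemma3p4 d@(suc _) a b _ H degˣ<d = colouring , isomorphic , star-forests , Δ-Rest<d
  where
  open Splitting d H
  split-colouring = konig-edge-colouring Split (Δ-Split≤ (λ x → <⇒≤ (degˣ<d x)))
  open BlockColouring d H (proj₁ split-colouring) (proj₁ (proj₂ split-colouring)) (proj₂ (proj₂ split-colouring))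

  isomorphic : ∀ i j → Isomorphic (Class i) (Class j)
  isomorphic i j = isomorphic-by-degreesʸ (Class i) (Class j) (class-at-most-one i) (class-at-most-one j)
    (λ y → trans (degʸ-Class i y) (sym (degʸ-Class j y)))

  star-forests : ∀ i → StarForestBounded (Class i) b d (Δ H)
  star-forests i = star-forest-centred-in-Y (Class i) {d} (class-at-most-one i) λ y → begin
    d * deg (Class i) (inj₂ y)  ≡⟨ cong (d *_) (degʸ-Class i y) ⟩
    d * blocks y                ≡⟨ *-comm d (blocks y) ⟩
    blocks y * d                ≤⟨ m/n*n≤m (deg H (inj₂ y)) d ⟩
    deg H (inj₂ y)              ≤⟨ deg≤Δ H (inj₂ y) ⟩
    Δ H                         ∎
    where open ≤-Reasoning

  Δ-Rest<d : Δ Rest < d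
  Δ-Rest<d = Δ< Rest (s≤s z≤n) λ
    { (inj₁ x) → ≤-<-trans (degˣ-Rest≤ x) (degˣ<d x)
    ; (inj₂ y) → degʸ-Rest y }
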